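{- Let $c\in\mathbb N^m$ and let $M$ be a proper $c$-multicomplex. Then for every prime $p$, $$f_0(\mathrm{Bier}_c(M))-|c|\le s(\mathrm{Bier}_c(M))\le s_p(\mathrm{Bier}_c(M))\le f_0(\mathrm{Bier}_c(M))-|c|+1,$$ where $f_0(\mathrm{Bier}_c(M))$ is the number of (real) vertices of $\mathrm{Bier}_c(M)$.
   Context: Here $c=(c_1,\ldots,c_m)$ with all $c_i\ge1$ integers and $|c|=c_1+\cdots+c_m$. A $c$-monomial is $x^a=x_1^{a_1}\cdots x_m^{a_m}$ with $0\le a_i\le c_i$. A $c$-multicomplex is a nonempty set $M$ of $c$-monomials closed under taking divisors; proper means not the set of all $c$-monomials. Let $\tilde X=\{x_i^{(j)}: 1\le i\le m,\ 0\le j\le c_i\}$. For a $c$-monomial $x^a$, $1\le i\le m$, $a_i<j\le c_i$, put $G(x^a;x_i^j)=\tilde X\setminus\{x_1^{(a_1)},\ldots,x_m^{(a_m)},x_i^{(j)}\}$ and let $x^a\diamond x_i^j$ be obtained from $x^a$ by replacing $a_i$ by $j$. The Murai sphere $\mathrm{Bier}_c(M)$ is the simplicial complex on $\tilde X$ whose facets are the sets $G(x^a;x_i^j)$ with $x^a\in M$, $a_i<j\le c_i$, $x^a\diamond x_i^j\notin M$; it is a sphere of dimension $|c|-2$. Its real vertices are the elements $v\in\tilde X$ with $\{v\}$ a face. For a simplicial complex $K$ with set $V$ of $N$ real vertices, the complex Buchstaber number $s(K)$ is the largest integer $r$ for which there is a map $\Lambda:V\to\mathbb Z^{N-r}$ such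 that for every simplex of $K$ the images of its vertices form part of a basis of the lattice $\mathbb Z^{N-r}$. For a prime $p$, the mod $p$ Buchstaber number $s_p(K)$ is the largest $r$ for which there is a map $\Lambda_p:V\to\mathbb Z_p^{N-r}$ such that for every simplex of $K$ the images of its vertices are linearly independent over $\mathbb Z_p$. -}

module Defs where

open import Data.Nat using (ℕ; zero; suc; _+_; _*_; _∸_; _≤_; _<_)
open import Data.Integer as ℤ using (ℤ)
open import Data.Fin using (Fin; toℕ; _≟_)
open import Data.Vec using (Vec; []; _∷_; replicate; zipWith; map; lookup; fromList; tabulate; sum; _++_)
open import Data.List as List using (List; [_]; length)
open import Data.List.Relation.Unary.All using (All)
open import Data.List.Relation.Unary.Unique.Propositional using (Unique)
open import Data.List.Membership.Propositional using (_∈_)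
open import Data.Bool using (Bool; true; false)
open import Data.Product using (Σ; _×_; _,_; ∃; ∃-syntax; proj₁; proj₂)
open import Data.Nat.Divisibility using (_∣_)
open import Relation.Binary.PropositionalEquality using (_≡_; _≢_; refl)
open import Relation.Nullary using (¬_; yes; no)
open import Function.Bundles using (_⇔_)

∣_∣c : {m : ℕ} → (Fin m → ℕ) → ℕ
∣ c ∣c = sum (tabulate c)

Mono : {m : ℕ} → (Fin m → ℕ) → Set
Mono {m} c = (i : Fin m) → Fin (suc (c i))

_∣ᵐ_ : {m : ℕ} {c : Fin m → ℕ} → Mono c → Mono c → Set
_∣ᵐ_ {m} b a = (i : Fin m) → toℕ (b i) ≤ toℕ (a i)

MonoSet : {m : ℕ} → (Fin m → ℕ) → Set
MonoSet c = Mono c → Bool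

IsMulticomplex : {m : ℕ} (c : Fin m → ℕ) → MonoSet c → Set
IsMulticomplex c M =
  (∃[ a ] M a ≡ true) ×
  (∀ (a b : Mono c) → b ∣ᵐ a → M a ≡ true → M b ≡ true)

IsProper : {m : ℕ} (c : Fin m → ℕ) → MonoSet c → Set
IsProper c M = ∃[ a ] M a ≡ false

-- ground set X̃ = { x_i^(j) : 1 ≤ i ≤ m, 0 ≤ j ≤ c_i }
Vertex : {m : ℕ} → (Fin m → ℕ) → Set
Vertex {m} c = Σ (Fin m) (λ i → Fin (suc (c i)))

_◇_ : {m : ℕ} {c : Fin m → ℕ} → Mono c → Vertex c → Mono c
(a ◇ (i , j)) k with k ≟ i
... | yes refl = j
... | no _ = a k

-- data indexing a facet G(x^a ; x_i^j)
record FacetData {m : ℕ} (c : Fin m → ℕ) (M : MonoSet c) : Set where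
  field
    mono    : Mono c
    var     : Fin m
    expo    : Fin (suc (c var))
    inM     : M mono ≡ true
    larger  : toℕ (mono var) < toℕ expo
    notInM  : M (mono ◇ (var , expo)) ≡ false

InFacet : {m : ℕ} {c : Fin m → ℕ} {M : MonoSet c} → FacetData c M → Vertex c → Set
InFacet F (k , t) =
  (t ≢ FacetData.mono F k) × ((k , t) ≢ (FacetData.var F , FacetData.expo F))

IsSimplex : {m : ℕ} (c : Fin m → ℕ) (M : MonoSet c) → List (Vertex c) → Set
IsSimplex c M σ = Unique σ × (∃[ F ] All (InFacet {M = M} F) σ)

IsRealVertex : {m : ℕ} (c : Fin m → ℕ) (M : MonoSet c) → Vertex c → Set
IsRealVertex c M v = IsSimplex c M [ v ]

NumRealVertices : {m : ℕ} (c : Fin m → ℕ) (M : MonoSet c) → ℕ → Set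
NumRealVertices c M N =
  ∃[ l ] (Unique l × length l ≡ N × (∀ v → (v ∈ l) ⇔ IsRealVertex c M v))

combℤ : {k n : ℕ} → Vec (Vec ℤ k) n → Vec ℤ n → Vec ℤ k
combℤ {k} [] [] = replicate k (ℤ.+ 0)
combℤ (v ∷ vs) (a ∷ as) = zipWith ℤ._+_ (map (a ℤ.*_) v) (combℤ vs as)

LinIndepℤ : {k n : ℕ} → Vec (Vec ℤ k) n → Set
LinIndepℤ {k} {n} vs = ∀ as → combℤ vs as ≡ replicate k (ℤ.+ 0) → as ≡ replicate n (ℤ.+ 0)

Spansℤ : {k n : ℕ} → Vec (Vec ℤ k) n → Set
Spansℤ vs = ∀ w → ∃[ as ] combℤ vs as ≡ w

IsBasisℤ : {k n : ℕ} → Vec (Vec ℤ k) n → Set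
IsBasisℤ vs = LinIndepℤ vs × Spansℤ vs

PartOfBasisℤ : {k n : ℕ} → Vec (Vec ℤ k) n → Set
PartOfBasisℤ {k} vs = ∃[ n' ] Σ (Vec (Vec ℤ k) n') (λ ws → IsBasisℤ (vs ++ ws))

-- ℤ_p is represented by Fin p (residues 0,…,p-1).
-- Σ a_t v_t computed in ℕ on representatives (to be read mod p)
combₚ : {p k n : ℕ} → Vec (Vec (Fin p) k) n → Vec (Fin p) n → Vec ℕ k
combₚ {k = k} [] [] = replicate k 0
combₚ (v ∷ vs) (a ∷ as) = zipWith _+_ (map (λ x → toℕ a * toℕ x) v) (combₚ vs as)

LinIndepₚ : {p k n : ℕ} → Vec (Vec (Fin p) k) n → Set
LinIndepₚ {p} {k} {n} vs =
  ∀ as → (∀ (r : Fin k) → p ∣ lookup (combₚ vs as) r) → ∀ (t : Fin n) → toℕ (lookup as t) ≡ 0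

ZCharMap : (V : Set) → (List V → Set) → ℕ → Set
ZCharMap V Simp k =
  Σ (V → Vec ℤ k) (λ Λ → ∀ σ → Simp σ → PartOfBasisℤ (fromList (List.map Λ σ)))

PCharMap : (p : ℕ) (V : Set) → (List V → Set) → ℕ → Set
PCharMap p V Simp k =
  Σ (V → Vec (Fin p) k) (λ Λ → ∀ σ → Simp σ → LinIndepₚ (fromList (List.map Λ σ)))

IsComplexBuchstaber : (V : Set) → (List V → Set) → (N s : ℕ) → Set
IsComplexBuchstaber V Simp N s =
  (s ≤ N × ZCharMap V Simp (N ∸ s)) ×
  (∀ r → r ≤ N → ZCharMap V Simp (N ∸ r) → r ≤ s)

IsModpBuchstaber : (p : ℕ) (V : Set) → (List V → Set) → (N s : ℕ) → Set
IsModpBuchstaber p V Simp N s =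
  (s ≤ N × PCharMap p V Simp (N ∸ s)) ×
  (∀ r → r ≤ N → PCharMap p V Simp (N ∸ r) → r ≤ s)

module Submission where

-- Sending x_k^(j) to the unit vector e_(k,j) of ℤ^|c| for j ≥ 1 and x_k^(0) to −Σⱼ e_(k,j), the
-- |c| vertices x_k^(t) with t ≠ a_k go to a lattice basis for every c-monomial x^a. Every simplex
-- of Bier_c(M) lies among such vertices, so this is a characteristic map into ℤ^|c| and
-- f₀ − s ≤ |c|. A part of a lattice basis stays linearly independent mod p, so s ≤ s_p. Finally,
-- walking from 1 ∈ M to a monomial outside M one finds a facet; it has |c| − 1 vertices, which are
-- independent in ℤ_p^(f₀ − s_p), and comparing the p^(|c|−1) combinations with the size of
-- ℤ_p^(f₀ − s_p) gives |c| − 1 ≤ f₀ − s_p.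

open import Defs

import Algebra.Properties.Semiring.Sum as Sum
open import Data.Fin as Fin using (Fin; zero; suc)
import Data.Integer.Properties as ℤP
import Data.Nat.Properties as ℕP
open import Data.Product using (Σ; ∃; _×_; _,_; proj₁; proj₂)
open import Function using (_∘_)
open import Relation.Binary.PropositionalEquality
open import Relation.Nullary using (¬_; yes; no; contradiction)

module ℕ∑ = Sum ℕP.+-*-semiring
module ℤ∑ = Sum ℤP.+-*-semiring
open ℤ∑ using (sum; sum-syntax; sum-cong-≗; ∑-distrib-+)

module VectorsAndLists where

  open import Data.Fin using (punchIn)
  open import Data.Fin.Properties using (punchIn-injective; punchInᵢ≢i)
  open import Data.List as List using (List)
  open import Data.List.Properties using (length-tabulate)
  import Data.List.Relation.Unary.All as ListAll
  import Data.List.Relation.Unary.All.Properties as ListAllP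
  open import Data.List.Relation.Unary.AllPairs using ([]; _∷_)
  import Data.List.Relation.Unary.Unique.Propositional as List
  import Data.List.Relation.Unary.Unique.Propositional.Properties as ListUnique
  import Data.Nat as ℕ
  open import Data.Vec using (Vec; []; _∷_; lookup; map; fromList; toList)
  open import Data.Vec.Properties using (tabulate∘lookup; tabulate-cong)
  import Data.Vec.Relation.Unary.All.Properties as VecAll
  open import Data.Vec.Relation.Unary.AllPairs using ([]; _∷_)
  open import Data.Vec.Relation.Unary.Unique.Propositional using (Unique)

  lookup-extensionality : ∀ {A : Set} {n} (xs ys : Vec A n) → (∀ i → lookup xs i ≡ lookup ys i) → xs ≡ ys
  lookup-extensionality xs ys eq = trans (sym (tabulate∘lookup xs)) (trans (tabulate-cong eq) (tabulate∘lookup ys))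

  module _ {A B : Set} (f : A → B) where

    fromList-map⁺ : (P : ∀ {n} → Vec B n → Set) (σ : List A) → P (map f (fromList σ)) → P (fromList (List.map f σ))
    fromList-map⁺ P List.[] p = p
    fromList-map⁺ P (x List.∷ σ) p = fromList-map⁺ (λ v → P (f x ∷ v)) σ p

    fromList-map⁻ : (P : ∀ {n} → Vec B n → Set) (σ : List A) → P (fromList (List.map f σ)) → P (map f (fromList σ))
    fromList-map⁻ P List.[] p = p
    fromList-map⁻ P (x List.∷ σ) p = fromList-map⁻ (λ v → P (f x ∷ v)) σ p

  tabulate-except : ∀ {A : Set} {N} (g : Fin N → A) → (∀ {r r′} → g r ≡ g r′ → r ≡ r′) → (r₀ : Fin N) →
    (P : A → Set) → (∀ r → r ≢ r₀ → P (g r)) →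
    ∃ λ σ → ℕ.suc (List.length σ) ≡ N × List.Unique σ × ListAll.All P σ
  tabulate-except {N = ℕ.suc n} g g-injective r₀ P P-g =
    List.tabulate (g ∘ punchIn r₀) ,
    cong ℕ.suc (length-tabulate (g ∘ punchIn r₀)) ,
    ListUnique.tabulate⁺ (punchIn-injective r₀ _ _ ∘ g-injective) ,
    ListAllP.tabulate⁺ (λ s → P-g (punchIn r₀ s) (punchInᵢ≢i r₀ s))

  toList⁻-Unique : ∀ {A : Set} {n} (xs : Vec A n) → List.Unique (toList xs) → Unique xs
  toList⁻-Unique [] [] = []
  toList⁻-Unique (x ∷ xs) (x∉xs ∷ unique) = VecAll.toList⁻ x∉xs ∷ toList⁻-Unique xs unique

module IntegerLattices where

  open import Algebra.Properties.Ring ℤP.+-*-ring using ([y-z]x≈yx-zx)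
  open import Data.Fin using (punchIn)
  open import Data.Fin.Properties using (punchInᵢ≢i)
  open import Data.Integer using (ℤ; 0ℤ; _+_; _*_; _-_)
  open import Data.Integer.Tactic.RingSolver using (solve-∀)
  import Data.Nat as ℕ
  open import Data.Vec using (Vec; []; _∷_; lookup; replicate; map; zipWith; _++_)
  open import Data.Vec.Properties using (lookup-zipWith; lookup-map; lookup-replicate)
  open VectorsAndLists

  ∑-zero : ∀ {n} (f : Fin n → ℤ) → (∀ i → f i ≡ 0ℤ) → ∑[ i < n ] f i ≡ 0ℤ
  ∑-zero {n} f f≡0 = trans (sum-cong-≗ f≡0) (ℤ∑.sum-replicate-zero n)

  ∑-select : ∀ {n} (f : Fin n → ℤ) (i : Fin n) → (∀ j → j ≢ i → f j ≡ 0ℤ) → ∑[ j < n ] f j ≡ f i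
  ∑-select {ℕ.suc n} f i f≡0 = begin
    sum f                     ≡⟨ ℤ∑.sum-remove f ⟩
    f i + sum (f ∘ punchIn i) ≡⟨ cong (λ x → f i + x) (∑-zero _ (λ j → f≡0 (punchIn i j) (punchInᵢ≢i i j))) ⟩
    f i + 0ℤ                  ≡⟨ ℤP.+-identityʳ (f i) ⟩
    f i                       ∎
    where open ≡-Reasoning

  ∑-distrib-- : ∀ {n} (f g : Fin n → ℤ) → ∑[ i < n ] (f i - g i) ≡ ∑[ i < n ] f i - ∑[ i < n ] g i
  ∑-distrib-- {ℕ.zero} f g = refl
  ∑-distrib-- {ℕ.suc n} f g =
    trans (cong (λ x → (f zero - g zero) + x) (∑-distrib-- (f ∘ suc) (g ∘ suc)))
          (interchange (f zero) (g zero) (sum (f ∘ suc)) (sum (g ∘ suc)))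
    where
    interchange : ∀ a b c d → (a - b) + (c - d) ≡ (a + c) - (b + d)
    interchange = solve-∀

  combℤ-lookup : ∀ {k n} (vs : Vec (Vec ℤ k) n) (as : Vec ℤ n) (r : Fin k) →
    lookup (combℤ vs as) r ≡ ∑[ i < n ] (lookup as i * lookup (lookup vs i) r)
  combℤ-lookup [] [] r = lookup-replicate r 0ℤ
  combℤ-lookup (v ∷ vs) (a ∷ as) r = begin
    lookup (zipWith _+_ (map (a *_) v) (combℤ vs as)) r
      ≡⟨ lookup-zipWith _+_ r (map (a *_) v) (combℤ vs as) ⟩
    lookup (map (a *_) v) r + lookup (combℤ vs as) r
      ≡⟨ cong₂ _+_ (lookup-map r (a *_) v) (combℤ-lookup vs as r) ⟩
    a * lookup v r + ∑[ i < _ ] (lookup as i * lookup (lookup vs i) r) ∎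
    where open ≡-Reasoning

  combℤ-zero : ∀ {k n} (vs : Vec (Vec ℤ k) n) → combℤ vs (replicate n 0ℤ) ≡ replicate k 0ℤ
  combℤ-zero {k} {n} vs = lookup-extensionality _ _ λ r → begin
    lookup (combℤ vs (replicate n 0ℤ)) r
      ≡⟨ combℤ-lookup vs _ r ⟩
    ∑[ i < n ] (lookup (replicate n 0ℤ) i * lookup (lookup vs i) r)
      ≡⟨ ∑-zero _ (λ i → cong (_* lookup (lookup vs i) r) (lookup-replicate i 0ℤ)) ⟩
    0ℤ
      ≡⟨ lookup-replicate r 0ℤ ⟨
    lookup (replicate k 0ℤ) r ∎
    where open ≡-Reasoning

  combℤ-scale : ∀ {k n} (vs : Vec (Vec ℤ k) n) (z : ℤ) (as : Vec ℤ n) →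
    combℤ vs (map (z *_) as) ≡ map (z *_) (combℤ vs as)
  combℤ-scale {n = n} vs z as = lookup-extensionality _ _ λ r → begin
    lookup (combℤ vs (map (z *_) as)) r
      ≡⟨ combℤ-lookup vs _ r ⟩
    ∑[ i < n ] (lookup (map (z *_) as) i * lookup (lookup vs i) r)
      ≡⟨ sum-cong-≗ (λ i → trans (cong (_* lookup (lookup vs i) r) (lookup-map i (z *_) as))
                                (ℤP.*-assoc z (lookup as i) _)) ⟩
    ∑[ i < n ] (z * (lookup as i * lookup (lookup vs i) r))
      ≡⟨ ℤ∑.*-distribˡ-sum z (λ i → lookup as i * lookup (lookup vs i) r) ⟨
    z * ∑[ i < n ] (lookup as i * lookup (lookup vs i) r)
      ≡⟨ cong (z *_) (combℤ-lookup vs as r) ⟨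
    z * lookup (combℤ vs as) r
      ≡⟨ lookup-map r (z *_) (combℤ vs as) ⟨
    lookup (map (z *_) (combℤ vs as)) r ∎
    where open ≡-Reasoning

  combℤ-++-zeros : ∀ {k n n′} (vs : Vec (Vec ℤ k) n) (ws : Vec (Vec ℤ k) n′) (as : Vec ℤ n) →
    combℤ (vs ++ ws) (as ++ replicate n′ 0ℤ) ≡ combℤ vs as
  combℤ-++-zeros [] ws [] = combℤ-zero ws
  combℤ-++-zeros (v ∷ vs) ws (a ∷ as) = cong (zipWith _+_ (map (a *_) v)) (combℤ-++-zeros vs ws as)

  combℤ-injective : ∀ {k n} (vs : Vec (Vec ℤ k) n) → LinIndepℤ vs →
    ∀ as bs → combℤ vs as ≡ combℤ vs bs → as ≡ bs
  combℤ-injective {k} {n} vs indep as bs eq = lookup-extensionality as bs λ i →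
    ℤP.i-j≡0⇒i≡j _ _ (trans (sym (lookup-zipWith _-_ i as bs))
                         (trans (cong (λ xs → lookup xs i) (indep ds ds-kernel)) (lookup-replicate i 0ℤ)))
    where
    ds = zipWith _-_ as bs
    ds-kernel : combℤ vs ds ≡ replicate k 0ℤ
    ds-kernel = lookup-extensionality _ _ λ r → begin
      lookup (combℤ vs ds) r
        ≡⟨ combℤ-lookup vs ds r ⟩
      ∑[ i < n ] (lookup ds i * lookup (lookup vs i) r)
        ≡⟨ sum-cong-≗ (λ i → trans (cong (_* lookup (lookup vs i) r) (lookup-zipWith _-_ i as bs))
                                  ([y-z]x≈yx-zx (lookup (lookup vs i) r) (lookup as i) (lookup bs i))) ⟩
      ∑[ i < n ] (lookup as i * lookup (lookup vs i) r - lookup bs i * lookup (lookup vs i) r)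
        ≡⟨ ∑-distrib-- (λ i → lookup as i * lookup (lookup vs i) r) (λ i → lookup bs i * lookup (lookup vs i) r) ⟩
      ∑[ i < n ] (lookup as i * lookup (lookup vs i) r) - ∑[ i < n ] (lookup bs i * lookup (lookup vs i) r)
        ≡⟨ cong₂ _-_ (combℤ-lookup vs as r) (combℤ-lookup vs bs r) ⟨
      lookup (combℤ vs as) r - lookup (combℤ vs bs) r
        ≡⟨ ℤP.i≡j⇒i-j≡0 (cong (λ xs → lookup xs r) eq) ⟩
      0ℤ
        ≡⟨ lookup-replicate r 0ℤ ⟨
      lookup (replicate k 0ℤ) r ∎
      where open ≡-Reasoning

  inverse⇒basis : ∀ {k n} (vs : Vec (Vec ℤ k) n) (φ : Vec ℤ k → Vec ℤ n) →
    (∀ as → φ (combℤ vs as) ≡ as) → (∀ w → combℤ vs (φ w) ≡ w) → IsBasisℤ vs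
  inverse⇒basis {n = n} vs φ φ-left φ-right = independent , λ w → φ w , φ-right w
    where
    independent : LinIndepℤ vs
    independent as as-kernel = begin
      as                            ≡⟨ φ-left as ⟨
      φ (combℤ vs as)               ≡⟨ cong φ (trans as-kernel (sym (combℤ-zero vs))) ⟩
      φ (combℤ vs (replicate n 0ℤ)) ≡⟨ φ-left _ ⟩
      replicate n 0ℤ                ∎
      where open ≡-Reasoning

module ModularReduction where

  open import Data.Fin using (toℕ; fromℕ<; finToFun; funToFin)
  open import Data.Fin.Properties using (toℕ-fromℕ<; toℕ<n; toℕ-injective; finToFun-funToFin; funToFin-finToFin; injective⇒≤)
  open import Data.Nat using (ℕ; suc; pred; _+_; _*_; _%_; _^_; _≤_; _<_; NonZero)
  open import Data.Nat.DivMod using (m%n<n; m<n⇒m%n≡m; %-distribˡ-+; %-distribˡ-*; m%n%n≡m%n; m*n%n≡0; %-remove-+ˡ; %-remove-+ʳ)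
  open import Data.Nat.Divisibility using (_∣_; m%n≡0⇒n∣m; m∣m*n)
  open import Data.Vec using (Vec; []; _∷_; lookup; tabulate; map; zipWith)
  open import Data.Vec.Properties using (lookup-zipWith; lookup-map; lookup-replicate; lookup∘tabulate)
  open VectorsAndLists
  open IntegerLattices

  combₚ-lookup : ∀ {p k n} (vs : Vec (Vec (Fin p) k) n) (as : Vec (Fin p) n) (r : Fin k) →
    lookup (combₚ vs as) r ≡ ℕ∑.sum (λ t → toℕ (lookup as t) * toℕ (lookup (lookup vs t) r))
  combₚ-lookup [] [] r = lookup-replicate r 0
  combₚ-lookup (v ∷ vs) (a ∷ as) r = begin
    lookup (zipWith _+_ (map (λ x → toℕ a * toℕ x) v) (combₚ vs as)) r
      ≡⟨ lookup-zipWith _+_ r (map (λ x → toℕ a * toℕ x) v) (combₚ vs as) ⟩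
    lookup (map (λ x → toℕ a * toℕ x) v) r + lookup (combₚ vs as) r
      ≡⟨ cong₂ _+_ (lookup-map r (λ x → toℕ a * toℕ x) v) (combₚ-lookup vs as r) ⟩
    toℕ a * toℕ (lookup v r) + ℕ∑.sum (λ t → toℕ (lookup as t) * toℕ (lookup (lookup vs t) r)) ∎
    where open ≡-Reasoning

  funToFin-cong : ∀ {m n} {f g : Fin m → Fin n} → (∀ i → f i ≡ g i) → funToFin f ≡ funToFin g
  funToFin-cong {ℕ.zero} f≗g = refl
  funToFin-cong {suc m} f≗g = cong₂ Fin.combine (f≗g zero) (funToFin-cong (f≗g ∘ suc))

  module _ (p : ℕ) .{{_ : NonZero p}} where

    infix 4 _≡ₚ_
    _≡ₚ_ : ℕ → ℕ → Set
    x ≡ₚ y = x % p ≡ y % p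

    +-≡ₚ : ∀ {x x′ y y′} → x ≡ₚ x′ → y ≡ₚ y′ → x + y ≡ₚ x′ + y′
    +-≡ₚ {x} {x′} {y} {y′} x≡x′ y≡y′ =
      trans (%-distribˡ-+ x y p) (trans (cong₂ (λ u v → (u + v) % p) x≡x′ y≡y′) (sym (%-distribˡ-+ x′ y′ p)))

    *-≡ₚ : ∀ {x x′ y y′} → x ≡ₚ x′ → y ≡ₚ y′ → x * y ≡ₚ x′ * y′
    *-≡ₚ {x} {x′} {y} {y′} x≡x′ y≡y′ =
      trans (%-distribˡ-* x y p) (trans (cong₂ (λ u v → (u * v) % p) x≡x′ y≡y′) (sym (%-distribˡ-* x′ y′ p)))

    ∑-≡ₚ : ∀ {n} (f g : Fin n → ℕ) → (∀ t → f t ≡ₚ g t) → ℕ∑.sum f ≡ₚ ℕ∑.sum g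
    ∑-≡ₚ {ℕ.zero} f g f≡g = refl
    ∑-≡ₚ {suc n} f g f≡g = +-≡ₚ (f≡g zero) (∑-≡ₚ (f ∘ suc) (g ∘ suc) (f≡g ∘ suc))

    reduce : ℕ → Fin p
    reduce x = fromℕ< (m%n<n x p)

    toℕ-reduce : ∀ x → toℕ (reduce x) ≡ x % p
    toℕ-reduce x = toℕ-fromℕ< (m%n<n x p)

    reduce-≡ₚ : ∀ x → toℕ (reduce x) ≡ₚ x
    reduce-≡ₚ x = trans (cong (_% p) (toℕ-reduce x)) (m%n%n≡m%n x p)

    -- Over ℤ_p, a − b is represented by a + (p − 1) b, which avoids truncated subtraction.
    p∣a+[p-1]b⇒a≡b : ∀ {a b} → a < p → b < p → p ∣ a + pred p * b → a ≡ b
    p∣a+[p-1]b⇒a≡b {a} {b} a<p b<p p∣a-b = begin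
      a                        ≡⟨ m<n⇒m%n≡m a<p ⟨
      a % p                    ≡⟨ %-remove-+ʳ a (m∣m*n b) ⟨
      (a + p * b) % p          ≡⟨ cong (_% p) shift ⟨
      (a + pred p * b + b) % p ≡⟨ %-remove-+ˡ b p∣a-b ⟩
      b % p                    ≡⟨ m<n⇒m%n≡m b<p ⟩
      b                        ∎
      where
      open ≡-Reasoning
      shift : a + pred p * b + b ≡ a + p * b
      shift = begin
        a + pred p * b + b   ≡⟨ ℕP.+-assoc a _ b ⟩
        a + (pred p * b + b) ≡⟨ cong (a +_) (ℕP.+-comm _ b) ⟩
        a + suc (pred p) * b ≡⟨ cong (λ q → a + q * b) (ℕP.suc-pred p) ⟩
        a + p * b            ∎

    combₚ-injective : ∀ {k n} (vs : Vec (Vec (Fin p) k) n) → LinIndepₚ vs → ∀ as bs →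
      (∀ r → lookup (combₚ vs as) r ≡ₚ lookup (combₚ vs bs) r) → as ≡ bs
    combₚ-injective {k} {n} vs indep as bs as≡bs = lookup-extensionality as bs λ t →
      toℕ-injective (p∣a+[p-1]b⇒a≡b (toℕ<n (lookup as t)) (toℕ<n (lookup bs t)) (m%n≡0⇒n∣m _ p (trans (sym (toℕ-reduce _))
                       (trans (cong toℕ (sym (lookup∘tabulate (reduce ∘ d) t))) (indep ds ds-kernel t)))))
      where
      a b : Fin n → ℕ
      a t = toℕ (lookup as t)
      b t = toℕ (lookup bs t)
      v : Fin n → Fin k → ℕ
      v t r = toℕ (lookup (lookup vs t) r)
      d : Fin n → ℕ
      d t = a t + pred p * b t
      ds = tabulate (reduce ∘ d)

      ds-kernel : ∀ r → p ∣ lookup (combₚ vs ds) r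
      ds-kernel r = m%n≡0⇒n∣m _ p (begin
        lookup (combₚ vs ds) r % p
          ≡⟨ cong (_% p) (combₚ-lookup vs ds r) ⟩
        ℕ∑.sum (λ t → toℕ (lookup ds t) * v t r) % p
          ≡⟨ ∑-≡ₚ _ (λ t → d t * v t r) (λ t → *-≡ₚ (trans (cong (λ x → toℕ x % p) (lookup∘tabulate (reduce ∘ d) t)) (reduce-≡ₚ (d t))) refl) ⟩
        ℕ∑.sum (λ t → d t * v t r) % p
          ≡⟨ cong (_% p) linear ⟩
        (ℕ∑.sum (λ t → a t * v t r) + pred p * ℕ∑.sum (λ t → b t * v t r)) % p
          ≡⟨ cong₂ (λ A B → (A + pred p * B) % p) (sym (combₚ-lookup vs as r)) (sym (combₚ-lookup vs bs r)) ⟩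
        (A + pred p * B) % p
          ≡⟨ +-≡ₚ {A} refl (*-≡ₚ {pred p} refl (sym (as≡bs r))) ⟩
        (A + pred p * A) % p
          ≡⟨ cong (λ q → (q * A) % p) (ℕP.suc-pred p) ⟩
        (p * A) % p
          ≡⟨ cong (_% p) (ℕP.*-comm p A) ⟩
        (A * p) % p
          ≡⟨ m*n%n≡0 A p ⟩
        0 ∎)
        where
        open ≡-Reasoning
        A = lookup (combₚ vs as) r
        B = lookup (combₚ vs bs) r
        linear : ℕ∑.sum (λ t → d t * v t r)
               ≡ ℕ∑.sum (λ t → a t * v t r) + pred p * ℕ∑.sum (λ t → b t * v t r)
        linear = trans (ℕ∑.sum-cong-≗ (λ t → trans (ℕP.*-distribʳ-+ (v t r) (a t) (pred p * b t))
                                                   (cong (λ s → a t * v t r + s) (ℕP.*-assoc (pred p) (b t) (v t r)))))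
                 (trans (ℕ∑.∑-distrib-+ (λ t → a t * v t r) (λ t → pred p * (b t * v t r)))
                        (cong (λ s → ℕ∑.sum (λ t → a t * v t r) + s) (sym (ℕ∑.*-distribˡ-sum (pred p) (λ t → b t * v t r)))))

    -- Injectivity of a ↦ Σ aₜ vₜ on ℤ_p^n gives an injection Fin (p ^ n) → Fin (p ^ k).
    independent⇒≤ : 1 < p → ∀ {k n} (vs : Vec (Vec (Fin p) k) n) → LinIndepₚ vs → n ≤ k
    independent⇒≤ 1<p {k} {n} vs indep =
      ℕP.≮⇒≥ λ k<n → ℕP.<⇒≱ (ℕP.^-monoʳ-< p 1<p k<n) (injective⇒≤ image-injective)
      where
      coefficients : Fin (p ^ n) → Vec (Fin p) n
      coefficients x = tabulate (finToFun x)

      image : Fin (p ^ n) → Fin (p ^ k)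
      image x = funToFin (λ r → reduce (lookup (combₚ vs (coefficients x)) r))

      image-injective : ∀ {x y} → image x ≡ image y → x ≡ y
      image-injective {x} {y} eq = begin
        x                             ≡⟨ funToFin-finToFin {n} {p} x ⟨
        funToFin (finToFun {p} {n} x) ≡⟨ funToFin-cong same-coefficients ⟩
        funToFin (finToFun {p} {n} y) ≡⟨ funToFin-finToFin {n} {p} y ⟩
        y                             ∎
        where
        open ≡-Reasoning
        same-reduction : ∀ r → reduce (lookup (combₚ vs (coefficients x)) r)
                             ≡ reduce (lookup (combₚ vs (coefficients y)) r)
        same-reduction r = trans (sym (finToFun-funToFin _ r))
                                 (trans (cong (λ z → finToFun z r) eq) (finToFun-funToFin _ r))
        same-coefficients : ∀ i → finToFun x i ≡ finToFun y i
        same-coefficients i =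
          trans (sym (lookup∘tabulate (finToFun x) i))
            (trans (cong (λ as → lookup as i)
                     (combₚ-injective vs indep _ _ λ r →
                        trans (sym (toℕ-reduce _)) (trans (cong toℕ (same-reduction r)) (toℕ-reduce _))))
                   (lookup∘tabulate (finToFun y) i))

module LatticeReduction where

  open import Data.Fin using (toℕ; fromℕ<; _↑ˡ_)
  open import Data.Fin.Properties using (toℕ-fromℕ<; toℕ<n)
  open import Data.Integer using (ℤ; 0ℤ; +_; ∣_∣; _+_; _*_; _/ℕ_)
  open import Data.Integer.DivMod using (n%ℕd<d; a≡a%ℕn+[a/ℕn]*n)
  open import Data.Integer.Tactic.RingSolver using (solve-∀)
  open import Data.Nat as ℕ using (ℕ; NonZero)
  open import Data.Nat.DivMod using (m<n⇒m%n≡m)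
  open import Data.Nat.Divisibility using (_∣_; divides; n∣m⇒m%n≡0)
  open import Data.Vec using (Vec; lookup; replicate; tabulate; map; _++_)
  open import Data.Vec.Properties using (lookup-map; lookup∘tabulate; lookup-++ˡ)
  open VectorsAndLists
  open IntegerLattices
  open ModularReduction using (combₚ-lookup)

  pos-∑ : ∀ {n} (f : Fin n → ℕ) → + ℕ∑.sum f ≡ ∑[ i < n ] (+ f i)
  pos-∑ {ℕ.zero} f = refl
  pos-∑ {ℕ.suc n} f = trans (ℤP.pos-+ (f zero) (ℕ∑.sum (f ∘ suc))) (cong (λ s → + f zero + s) (pos-∑ (f ∘ suc)))

  module _ (p : ℕ) .{{_ : NonZero p}} where

    reduceℤ : ℤ → Fin p
    reduceℤ x = fromℕ< (n%ℕd<d x p)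

    reduceℤ-split : ∀ x → x ≡ + toℕ (reduceℤ x) + (x /ℕ p) * + p
    reduceℤ-split x = trans (a≡a%ℕn+[a/ℕn]*n x p) (cong (λ q → + q + (x /ℕ p) * + p) (sym (toℕ-fromℕ< (n%ℕd<d x p))))

    combℤ-divisible : ∀ {k n} (vs : Vec (Vec ℤ k) n) (as : Vec (Fin p) n) →
      (∀ r → p ∣ lookup (combₚ (map (map reduceℤ) vs) as) r) →
      ∀ r → ∃ λ z → lookup (combℤ vs (map (+_ ∘ toℕ) as)) r ≡ + p * z
    combℤ-divisible {n = n} vs as divisible r with divisible r
    ... | divides c c*p = + c + S , (begin
      lookup (combℤ vs (map (+_ ∘ toℕ) as)) r
        ≡⟨ combℤ-lookup vs _ r ⟩
      ∑[ t < n ] (lookup (map (+_ ∘ toℕ) as) t * x t)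
        ≡⟨ sum-cong-≗ split ⟩
      ∑[ t < n ] (+ (a t ℕ.* x̄ t) + + a t * q t * + p)
        ≡⟨ ∑-distrib-+ (λ t → + (a t ℕ.* x̄ t)) (λ t → + a t * q t * + p) ⟩
      ∑[ t < n ] (+ (a t ℕ.* x̄ t)) + ∑[ t < n ] (+ a t * q t * + p)
        ≡⟨ cong₂ _+_ (sym (pos-∑ (λ t → a t ℕ.* x̄ t))) (sym (ℤ∑.*-distribʳ-sum (+ p) (λ t → + a t * q t))) ⟩
      + ℕ∑.sum (λ t → a t ℕ.* x̄ t) + S * + p
        ≡⟨ cong (λ m → + m + S * + p) (trans reduced-sum c*p) ⟩
      + (c ℕ.* p) + S * + p
        ≡⟨ factor-p ⟩
      + p * (+ c + S) ∎)
      where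
      open ≡-Reasoning
      a : Fin n → ℕ
      a t = toℕ (lookup as t)
      x q : Fin n → ℤ
      x t = lookup (lookup vs t) r
      q t = x t /ℕ p
      x̄ : Fin n → ℕ
      x̄ t = toℕ (reduceℤ (x t))
      S = ∑[ t < n ] (+ a t * q t)
      split : ∀ t → lookup (map (+_ ∘ toℕ) as) t * x t ≡ + (a t ℕ.* x̄ t) + + a t * q t * + p
      split t = begin
        lookup (map (+_ ∘ toℕ) as) t * x t   ≡⟨ cong₂ _*_ (lookup-map t (+_ ∘ toℕ) as) (reduceℤ-split (x t)) ⟩
        + a t * (+ x̄ t + q t * + p)          ≡⟨ distribute (+ a t) (+ x̄ t) (q t) (+ p) ⟩
        + a t * + x̄ t + + a t * q t * + p    ≡⟨ cong (_+ + a t * q t * + p) (ℤP.pos-* (a t) (x̄ t)) ⟨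
        + (a t ℕ.* x̄ t) + + a t * q t * + p  ∎
        where
        distribute : ∀ α β γ δ → α * (β + γ * δ) ≡ α * β + α * γ * δ
        distribute = solve-∀
      factor-p : + (c ℕ.* p) + S * + p ≡ + p * (+ c + S)
      factor-p = trans (cong (_+ S * + p) (ℤP.pos-* c p)) (factor (+ c) (+ p) S)
        where
        factor : ∀ γ π σ → γ * π + σ * π ≡ π * (γ + σ)
        factor = solve-∀
      reduced-sum : ℕ∑.sum (λ t → a t ℕ.* x̄ t) ≡ lookup (combₚ (map (map reduceℤ) vs) as) r
      reduced-sum = sym (trans (combₚ-lookup (map (map reduceℤ) vs) as r)
        (ℕ∑.sum-cong-≗ λ t → cong (λ y → a t ℕ.* toℕ y)
          (trans (cong (λ w → lookup w r) (lookup-map t (map reduceℤ) vs)) (lookup-map r reduceℤ (lookup vs t)))))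

    -- Σ aₜ vₜ ∈ p ℤ^k; writing its quotient by p in the basis vs ++ ws and comparing
    -- coefficients gives aₜ ∈ p ℤ, so aₜ = 0 as 0 ≤ aₜ < p.
    reduce-independent : ∀ {k n} (vs : Vec (Vec ℤ k) n) → PartOfBasisℤ vs → LinIndepₚ (map (map reduceℤ) vs)
    reduce-independent vs (n′ , ws , independent , spans) as divisible t =
      trans (sym (m<n⇒m%n≡m (toℕ<n (lookup as t)))) (n∣m⇒m%n≡0 _ p p∣aₜ)
      where
      A = map (+_ ∘ toℕ) as
      Z = tabulate (λ r → proj₁ (combℤ-divisible vs as divisible r))
      B = proj₁ (spans Z)

      A-multiple : combℤ vs A ≡ map (+ p *_) Z
      A-multiple = lookup-extensionality _ _ λ r →
        trans (proj₂ (combℤ-divisible vs as divisible r))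
              (sym (trans (lookup-map r (+ p *_) Z) (cong (+ p *_) (lookup∘tabulate _ r))))

      coefficients : A ++ replicate n′ 0ℤ ≡ map (+ p *_) B
      coefficients = combℤ-injective (vs ++ ws) independent _ _ (begin
        combℤ (vs ++ ws) (A ++ replicate n′ 0ℤ) ≡⟨ combℤ-++-zeros vs ws A ⟩
        combℤ vs A                             ≡⟨ A-multiple ⟩
        map (+ p *_) Z                         ≡⟨ cong (map (+ p *_)) (proj₂ (spans Z)) ⟨
        map (+ p *_) (combℤ (vs ++ ws) B)      ≡⟨ combℤ-scale (vs ++ ws) (+ p) B ⟨
        combℤ (vs ++ ws) (map (+ p *_) B)      ∎)
        where open ≡-Reasoning

      aₜ-multiple : + toℕ (lookup as t) ≡ + p * lookup B (t ↑ˡ n′)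
      aₜ-multiple = begin
        + toℕ (lookup as t)                   ≡⟨ lookup-map t (+_ ∘ toℕ) as ⟨
        lookup A t                            ≡⟨ lookup-++ˡ A (replicate n′ 0ℤ) t ⟨
        lookup (A ++ replicate n′ 0ℤ) (t ↑ˡ n′) ≡⟨ cong (λ w → lookup w (t ↑ˡ n′)) coefficients ⟩
        lookup (map (+ p *_) B) (t ↑ˡ n′)    ≡⟨ lookup-map (t ↑ˡ n′) (+ p *_) B ⟩
        + p * lookup B (t ↑ˡ n′)            ∎
        where open ≡-Reasoning

      p∣aₜ : p ∣ toℕ (lookup as t)
      p∣aₜ = divides ∣ lookup B (t ↑ˡ n′) ∣
        (trans (cong ∣_∣ aₜ-multiple) (trans (ℤP.abs-* (+ p) _) (ℕP.*-comm p _)))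

module BuchstaberNumbers where

  open import Data.List as List using (List; length)
  open import Data.List.Properties using (length-map)
  open import Data.Nat using (_+_; _∸_; _≤_; _<_; _≤?_; NonZero)
  open import Data.Vec using (fromList; map)
  open import Data.Vec.Properties using (map-∘)
  open VectorsAndLists
  open ModularReduction
  open LatticeReduction

  module _ {V : Set} {Simplex : List V → Set} where

    ZCharMap⇒N≤s+k : ∀ {N s k} → IsComplexBuchstaber V Simplex N s → ZCharMap V Simplex k → N ≤ s + k
    ZCharMap⇒N≤s+k {N} {s} {k} (_ , s-maximal) Λ with N ≤? k
    ... | yes N≤k = ℕP.≤-trans N≤k (ℕP.m≤n+m k s)
    ... | no N≰k = begin
      N               ≡⟨ ℕP.m∸n+n≡m k≤N ⟨
      (N ∸ k) + k     ≤⟨ ℕP.+-monoˡ-≤ k (s-maximal (N ∸ k) (ℕP.m∸n≤m N k) Λ′) ⟩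
      s + k           ∎
      where
      open ℕP.≤-Reasoning
      k≤N = ℕP.<⇒≤ (ℕP.≰⇒> N≰k)
      Λ′ : ZCharMap V Simplex (N ∸ (N ∸ k))
      Λ′ = subst (ZCharMap V Simplex) (sym (ℕP.m∸[m∸n]≡n k≤N)) Λ

    ZCharMap⇒PCharMap : ∀ p .{{_ : NonZero p}} {k} → ZCharMap V Simplex k → PCharMap p V Simplex k
    ZCharMap⇒PCharMap p (Λ , basis) = map (reduceℤ p) ∘ Λ , λ σ σ-simplex →
      fromList-map⁺ (map (reduceℤ p) ∘ Λ) LinIndepₚ σ
        (subst LinIndepₚ (sym (map-∘ (map (reduceℤ p)) Λ (fromList σ)))
          (reduce-independent p (map Λ (fromList σ)) (fromList-map⁻ Λ PartOfBasisℤ σ (basis σ σ-simplex))))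

    complex≤modp-Buchstaber : ∀ p .{{_ : NonZero p}} {N s sₚ} →
      IsComplexBuchstaber V Simplex N s → IsModpBuchstaber p V Simplex N sₚ → s ≤ sₚ
    complex≤modp-Buchstaber p ((s≤N , Λ) , _) (_ , sₚ-maximal) = sₚ-maximal _ s≤N (ZCharMap⇒PCharMap p Λ)

    modp-Buchstaber+length≤ : ∀ {p} .{{_ : NonZero p}} → 1 < p → ∀ {N sₚ} → IsModpBuchstaber p V Simplex N sₚ →
      ∀ σ → Simplex σ → sₚ + length σ ≤ N
    modp-Buchstaber+length≤ {p} 1<p {N} {sₚ} ((sₚ≤N , Λ , independent) , _) σ σ-simplex = begin
      sₚ + length σ         ≤⟨ ℕP.+-monoʳ-≤ sₚ length≤ ⟩
      sₚ + (N ∸ sₚ)         ≡⟨ ℕP.m+[n∸m]≡n sₚ≤N ⟩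
      N                     ∎
      where
      open ℕP.≤-Reasoning
      length≤ : length σ ≤ N ∸ sₚ
      length≤ = subst (_≤ N ∸ sₚ) (length-map Λ σ)
        (independent⇒≤ p 1<p (fromList (List.map Λ σ)) (independent σ σ-simplex))

module MuraiSphere where

  open import Algebra.Properties.Ring ℤP.+-*-ring using (x[y-z]≈xy-xz)
  open import Data.Bool using (Bool; true; false)
  open import Data.Fin using (splitAt; _↑ˡ_; _↑ʳ_; punchIn; punchOut)
  open import Data.Fin.Properties using (splitAt-↑ˡ; splitAt-↑ʳ; splitAt⁻¹-↑ˡ; splitAt⁻¹-↑ʳ; punchIn-injective; punchInᵢ≢i; punchIn-punchOut; toℕ-fromℕ<; toℕ-injective; toℕ<n)
  open import Data.Integer using (ℤ; 0ℤ; 1ℤ; _*_; _-_)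
  open import Data.Integer.Tactic.RingSolver using (solve-∀)
  import Data.List as List
  import Data.List.Membership.DecPropositional as DecMembership
  import Data.List.Membership.Propositional as List
  open import Data.List.Membership.Propositional.Properties using (∈-tabulate⁺; ∈-tabulate⁻; ∈-filter⁺; ∈-filter⁻; ∈-++⁺ˡ; ∈-++⁺ʳ; ∈-++⁻)
  import Data.List.Relation.Unary.All as ListAll
  import Data.List.Relation.Unary.Unique.Propositional as List
  import Data.List.Relation.Unary.Unique.Propositional.Properties as ListUnique
  open import Data.Nat as ℕ using (ℕ; _<?_)
  open import Data.Product.Properties using (≡-dec; Σ-≡,≡←≡)
  open import Data.Sum using (inj₁; inj₂)
  open import Data.Vec using (Vec; lookup; tabulate; map; _++_; fromList; toList)
  open import Data.Vec.Membership.Propositional using (_∈_)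
  open import Data.Vec.Membership.Propositional.Properties using (∈-lookup; ∈-toList⁺; ∈-toList⁻)
  open import Data.Vec.Properties using (lookup∘tabulate; lookup-map; map-++; toList-++; toList∘fromList)
  open import Data.Vec.Relation.Unary.Any using (index)
  open import Data.Vec.Relation.Unary.Any.Properties using (lookup-index)
  open import Data.Vec.Relation.Unary.Unique.Propositional using (Unique)
  open import Data.Vec.Relation.Unary.Unique.Propositional.Properties using (lookup-injective)
  open import Function using (flip)
  open import Relation.Binary.Definitions using (DecidableEquality)
  open import Relation.Nullary using (¬?)
  open VectorsAndLists
  open IntegerLattices

  Slot : ∀ {m} → (Fin m → ℕ) → Set
  Slot {m} c = Σ (Fin m) (λ k → Fin (c k))

  toCoordinate : ∀ {m} (c : Fin m → ℕ) → Slot c → Fin ∣ c ∣c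
  toCoordinate {ℕ.suc m} c (zero , l) = l ↑ˡ ∣ c ∘ suc ∣c
  toCoordinate {ℕ.suc m} c (suc k , l) = c zero ↑ʳ toCoordinate (c ∘ suc) (k , l)

  fromCoordinate : ∀ {m} (c : Fin m → ℕ) → Fin ∣ c ∣c → Slot c
  fromCoordinate {ℕ.suc m} c r with splitAt (c zero) r
  ... | inj₁ l = zero , l
  ... | inj₂ r′ with fromCoordinate (c ∘ suc) r′
  ...   | k , l = suc k , l

  fromCoordinate-toCoordinate : ∀ {m} (c : Fin m → ℕ) s → fromCoordinate c (toCoordinate c s) ≡ s
  fromCoordinate-toCoordinate {ℕ.suc m} c (zero , l) rewrite splitAt-↑ˡ (c zero) l ∣ c ∘ suc ∣c = refl
  fromCoordinate-toCoordinate {ℕ.suc m} c (suc k , l)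
    rewrite splitAt-↑ʳ (c zero) ∣ c ∘ suc ∣c (toCoordinate (c ∘ suc) (k , l))
          | fromCoordinate-toCoordinate (c ∘ suc) (k , l) = refl

  toCoordinate-fromCoordinate : ∀ {m} (c : Fin m → ℕ) r → toCoordinate c (fromCoordinate c r) ≡ r
  toCoordinate-fromCoordinate {ℕ.suc m} c r with splitAt (c zero) r in split
  ... | inj₁ l = splitAt⁻¹-↑ˡ split
  ... | inj₂ r′ with fromCoordinate (c ∘ suc) r′ in eq
  ...   | k , l = trans (cong (c zero ↑ʳ_) (trans (cong (toCoordinate (c ∘ suc)) (sym eq))
                                                 (toCoordinate-fromCoordinate (c ∘ suc) r′)))
                        (splitAt⁻¹-↑ʳ split)

  crossing : (f : ℕ → Bool) → f 0 ≡ true → ∀ n → f n ≡ false →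
    ∃ λ q → q ℕ.< n × f q ≡ true × f (ℕ.suc q) ≡ false
  crossing f f₀ ℕ.zero fₙ = contradiction (trans (sym f₀) fₙ) λ ()
  crossing f f₀ (ℕ.suc n) f₁₊ₙ with f n in fₙ
  ... | true = n , ℕP.≤-refl , fₙ , f₁₊ₙ
  ... | false with crossing f f₀ n fₙ
  ...   | q , q<n , f_q , f₁₊q = q , ℕP.m≤n⇒m≤1+n q<n , f_q , f₁₊q

  module _ {m : ℕ} (c : Fin m → ℕ) where

    _≟ᵛ_ : DecidableEquality (Vertex c)
    _≟ᵛ_ = ≡-dec Fin._≟_ Fin._≟_

    δ : Vertex c → Vertex c → ℤ
    δ y u with y ≟ᵛ u
    ... | yes _ = 1ℤ
    ... | no _ = 0ℤ

    δ-refl : ∀ u → δ u u ≡ 1ℤ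
    δ-refl u with u ≟ᵛ u
    ... | yes _ = refl
    ... | no u≢u = contradiction refl u≢u

    δ-≢ : ∀ {y u} → y ≢ u → δ y u ≡ 0ℤ
    δ-≢ {y} {u} y≢u with y ≟ᵛ u
    ... | yes y≡u = contradiction y≡u y≢u
    ... | no _ = refl

    -- The vertices that can occur in a facet G(x^a; x_i^j): all x_k^(t) with t ≠ a_k.
    Avoids : Mono c → Vertex c → Set
    Avoids a v = proj₂ v ≢ a (proj₁ v)

    Avoids⇒≢ : ∀ a {v} k → Avoids a v → v ≢ (k , a k)
    Avoids⇒≢ a k v-avoids refl = v-avoids refl

    skip : Mono c → Slot c → Vertex c
    skip a (k , l) = k , punchIn (a k) l

    skip-injective : ∀ a {s s′} → skip a s ≡ skip a s′ → s ≡ s′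
    skip-injective a {k , l} {k′ , l′} eq with Σ-≡,≡←≡ eq
    ... | refl , l≡l′ = cong (k ,_) (punchIn-injective (a k) l l′ l≡l′)

    avoiding : Mono c → Fin ∣ c ∣c → Vertex c
    avoiding a = skip a ∘ fromCoordinate c

    avoiding-avoids : ∀ a r → Avoids a (avoiding a r)
    avoiding-avoids a r = punchInᵢ≢i (a (proj₁ (fromCoordinate c r))) (proj₂ (fromCoordinate c r))

    avoiding-injective : ∀ a {r r′} → avoiding a r ≡ avoiding a r′ → r ≡ r′
    avoiding-injective a {r} {r′} eq = begin
      r                                   ≡⟨ toCoordinate-fromCoordinate c r ⟨
      toCoordinate c (fromCoordinate c r)  ≡⟨ cong (toCoordinate c) (skip-injective a eq) ⟩
      toCoordinate c (fromCoordinate c r′) ≡⟨ toCoordinate-fromCoordinate c r′ ⟩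
      r′                                  ∎
      where open ≡-Reasoning

    avoiding-surjective : ∀ a v → Avoids a v → ∃ λ r → avoiding a r ≡ v
    avoiding-surjective a (k , t) t≢aₖ = toCoordinate c (k , l) , (begin
      skip a (fromCoordinate c (toCoordinate c (k , l))) ≡⟨ cong (skip a) (fromCoordinate-toCoordinate c (k , l)) ⟩
      k , punchIn (a k) l                              ≡⟨ cong (k ,_) (punchIn-punchOut (t≢aₖ ∘ sym)) ⟩
      k , t                                            ∎)
      where
      open ≡-Reasoning
      l = punchOut (t≢aₖ ∘ sym)

    Λ-entry : Vertex c → Slot c → ℤ
    Λ-entry y (k , l) = δ y (k , suc l) - δ y (k , zero)

    Λ : Vertex c → Vec ℤ ∣ c ∣c
    Λ y = tabulate (Λ-entry y ∘ fromCoordinate c)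

    lookup-Λ : ∀ y s → lookup (Λ y) (toCoordinate c s) ≡ Λ-entry y s
    lookup-Λ y s = trans (lookup∘tabulate _ (toCoordinate c s)) (cong (Λ-entry y) (fromCoordinate-toCoordinate c s))

    value : Vec ℤ ∣ c ∣c → Vertex c → ℤ
    value w (k , zero) = 0ℤ
    value w (k , suc l) = lookup w (toCoordinate c (k , l))

    value-Λ : ∀ y u → value (Λ y) u ≡ δ y u - δ y (proj₁ u , zero)
    value-Λ y (k , zero) = sym (ℤP.+-inverseʳ (δ y (k , zero)))
    value-Λ y (k , suc l) = lookup-Λ y (k , l)

    value-combℤ : ∀ {n} (vs : Vec (Vec ℤ ∣ c ∣c) n) as u →
      value (combℤ vs as) u ≡ ∑[ i < n ] (lookup as i * value (lookup vs i) u)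
    value-combℤ vs as (k , zero) = sym (∑-zero _ (λ i → ℤP.*-zeroʳ (lookup as i)))
    value-combℤ vs as (k , suc l) = combℤ-lookup vs as (toCoordinate c (k , l))

    coefficient : Mono c → Vertex c → Vec ℤ ∣ c ∣c → ℤ
    coefficient a u w = value w u - value w (proj₁ u , a (proj₁ u))

    coefficient-Λ : ∀ a u y → coefficient a u (Λ y) ≡ δ y u - δ y (proj₁ u , a (proj₁ u))
    coefficient-Λ a u y = begin
      value (Λ y) u - value (Λ y) (k , a k)
        ≡⟨ cong₂ _-_ (value-Λ y u) (value-Λ y (k , a k)) ⟩
      (δ y u - δ y (k , zero)) - (δ y (k , a k) - δ y (k , zero))
        ≡⟨ cancel (δ y u) (δ y (k , a k)) (δ y (k , zero)) ⟩
      δ y u - δ y (k , a k) ∎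
      where
      open ≡-Reasoning
      k = proj₁ u
      cancel : ∀ α β γ → (α - γ) - (β - γ) ≡ α - β
      cancel = solve-∀

    coefficient-combℤ : ∀ {n} a u (vs : Vec (Vec ℤ ∣ c ∣c) n) as →
      coefficient a u (combℤ vs as) ≡ ∑[ i < n ] (lookup as i * coefficient a u (lookup vs i))
    coefficient-combℤ {n} a u vs as = begin
      value (combℤ vs as) u - value (combℤ vs as) u₀
        ≡⟨ cong₂ _-_ (value-combℤ vs as u) (value-combℤ vs as u₀) ⟩
      ∑[ i < n ] (lookup as i * value (lookup vs i) u) - ∑[ i < n ] (lookup as i * value (lookup vs i) u₀)
        ≡⟨ ∑-distrib-- (λ i → lookup as i * value (lookup vs i) u) (λ i → lookup as i * value (lookup vs i) u₀) ⟨
      ∑[ i < n ] (lookup as i * value (lookup vs i) u - lookup as i * value (lookup vs i) u₀)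
        ≡⟨ sum-cong-≗ (λ i → sym (x[y-z]≈xy-xz (lookup as i) _ _)) ⟩
      ∑[ i < n ] (lookup as i * coefficient a u (lookup vs i)) ∎
      where
      open ≡-Reasoning
      u₀ = proj₁ u , a (proj₁ u)

    -- Λ sends an enumeration without repetitions of the vertices avoided by x^a to a basis; the
    -- functionals w ↦ coefficient a u w invert as ↦ Σᵢ asᵢ Λ(xᵢ).
    module AvoidingEnumeration (a : Mono c) {n} (xs : Vec (Vertex c) n) (unique : Unique xs)
      (avoids : ∀ {v} → v ∈ xs → Avoids a v) (covers : ∀ v → Avoids a v → v ∈ xs) where

      open ≡-Reasoning

      x : Fin n → Vertex c
      x = lookup xs

      ∑-δ-lookup : (β : Fin n → ℤ) (t : Fin n) → ∑[ i < n ] (β i * δ (x i) (x t)) ≡ β t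
      ∑-δ-lookup β t = begin
        ∑[ i < n ] (β i * δ (x i) (x t))
          ≡⟨ ∑-select _ t (λ i i≢t → trans (cong (β i *_) (δ-≢ (i≢t ∘ lookup-injective unique i t))) (ℤP.*-zeroʳ (β i))) ⟩
        β t * δ (x t) (x t)  ≡⟨ cong (β t *_) (δ-refl (x t)) ⟩
        β t * 1ℤ             ≡⟨ ℤP.*-identityʳ (β t) ⟩
        β t                  ∎

      ∑-δ : (g : Vertex c → ℤ) → (∀ k → g (k , a k) ≡ 0ℤ) → ∀ u → ∑[ i < n ] (g (x i) * δ (x i) u) ≡ g u
      ∑-δ g g-vanishes (k , t) with t Fin.≟ a k
      ... | yes refl = trans (∑-zero _ (λ i → trans (cong (g (x i) *_) (δ-≢ (Avoids⇒≢ a k (avoids (∈-lookup i xs)))))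
                                                     (ℤP.*-zeroʳ (g (x i)))))
                             (sym (g-vanishes k))
      ... | no t≢aₖ = begin
        ∑[ i < n ] (g (x i) * δ (x i) (k , t))  ≡⟨ cong (λ u → ∑[ i < n ] (g (x i) * δ (x i) u)) xᵢ₀≡u ⟨
        ∑[ i < n ] (g (x i) * δ (x i) (x i₀))   ≡⟨ ∑-δ-lookup (g ∘ x) i₀ ⟩
        g (x i₀)                                ≡⟨ cong g xᵢ₀≡u ⟩
        g (k , t)                               ∎
        where
        u∈xs = covers (k , t) t≢aₖ
        i₀ = index u∈xs
        xᵢ₀≡u : x i₀ ≡ (k , t)
        xᵢ₀≡u = sym (lookup-index u∈xs)

      coordinates : Vec ℤ ∣ c ∣c → Vec ℤ n
      coordinates w = map (λ u → coefficient a u w) xs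

      coefficient-Λ-avoiding : ∀ i t → coefficient a (x t) (lookup (map Λ xs) i) ≡ δ (x i) (x t)
      coefficient-Λ-avoiding i t = begin
        coefficient a (x t) (lookup (map Λ xs) i)  ≡⟨ cong (coefficient a (x t)) (lookup-map i Λ xs) ⟩
        coefficient a (x t) (Λ (x i))              ≡⟨ coefficient-Λ a (x t) (x i) ⟩
        δ (x i) (x t) - δ (x i) (k , a k)          ≡⟨ cong (δ (x i) (x t) -_) (δ-≢ (Avoids⇒≢ a k (avoids (∈-lookup i xs)))) ⟩
        δ (x i) (x t) - 0ℤ                         ≡⟨ ℤP.+-identityʳ (δ (x i) (x t)) ⟩
        δ (x i) (x t)                              ∎
        where k = proj₁ (x t)

      coordinates-combℤ : ∀ as → coordinates (combℤ (map Λ xs) as) ≡ as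
      coordinates-combℤ as = lookup-extensionality _ as λ t → begin
        lookup (coordinates (combℤ (map Λ xs) as)) t
          ≡⟨ lookup-map t _ xs ⟩
        coefficient a (x t) (combℤ (map Λ xs) as)
          ≡⟨ coefficient-combℤ a (x t) (map Λ xs) as ⟩
        ∑[ i < n ] (lookup as i * coefficient a (x t) (lookup (map Λ xs) i))
          ≡⟨ sum-cong-≗ (λ i → cong (lookup as i *_) (coefficient-Λ-avoiding i t)) ⟩
        ∑[ i < n ] (lookup as i * δ (x i) (x t))
          ≡⟨ ∑-δ-lookup (lookup as) t ⟩
        lookup as t ∎

      combℤ-coordinates-at : ∀ w s →
        lookup (combℤ (map Λ xs) (coordinates w)) (toCoordinate c s) ≡ lookup w (toCoordinate c s)
      combℤ-coordinates-at w (k , l) = begin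
        lookup (combℤ (map Λ xs) (coordinates w)) r
          ≡⟨ combℤ-lookup (map Λ xs) (coordinates w) r ⟩
        ∑[ i < n ] (lookup (coordinates w) i * lookup (lookup (map Λ xs) i) r)
          ≡⟨ sum-cong-≗ (λ i → cong₂ _*_ (lookup-map i _ xs)
                                 (trans (cong (λ v → lookup v r) (lookup-map i Λ xs)) (lookup-Λ (x i) (k , l)))) ⟩
        ∑[ i < n ] (g (x i) * (δ (x i) (k , suc l) - δ (x i) (k , zero)))
          ≡⟨ sum-cong-≗ (λ i → x[y-z]≈xy-xz (g (x i)) _ _) ⟩
        ∑[ i < n ] (g (x i) * δ (x i) (k , suc l) - g (x i) * δ (x i) (k , zero))
          ≡⟨ ∑-distrib-- (λ i → g (x i) * δ (x i) (k , suc l)) (λ i → g (x i) * δ (x i) (k , zero)) ⟩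
        ∑[ i < n ] (g (x i) * δ (x i) (k , suc l)) - ∑[ i < n ] (g (x i) * δ (x i) (k , zero))
          ≡⟨ cong₂ _-_ (∑-δ g g-vanishes (k , suc l)) (∑-δ g g-vanishes (k , zero)) ⟩
        (lookup w r - value w (k , a k)) - (0ℤ - value w (k , a k))
          ≡⟨ cancel (lookup w r) (value w (k , a k)) ⟩
        lookup w r ∎
        where
        r = toCoordinate c (k , l)
        g : Vertex c → ℤ
        g u = coefficient a u w
        g-vanishes : ∀ k′ → g (k′ , a k′) ≡ 0ℤ
        g-vanishes k′ = ℤP.+-inverseʳ (value w (k′ , a k′))
        cancel : ∀ α β → (α - β) - (0ℤ - β) ≡ α
        cancel = solve-∀

      combℤ-coordinates : ∀ w → combℤ (map Λ xs) (coordinates w) ≡ w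
      combℤ-coordinates w = lookup-extensionality _ w λ r →
        subst (λ r → lookup (combℤ (map Λ xs) (coordinates w)) r ≡ lookup w r)
              (toCoordinate-fromCoordinate c r) (combℤ-coordinates-at w (fromCoordinate c r))

      basis : IsBasisℤ (map Λ xs)
      basis = inverse⇒basis (map Λ xs) coordinates coordinates-combℤ combℤ-coordinates

    completion : ∀ a σ → List.Unique σ → ListAll.All (Avoids a) σ →
      ∃ λ rest → List.Unique (σ List.++ rest) × (∀ {v} → v List.∈ σ List.++ rest → Avoids a v)
                 × (∀ v → Avoids a v → v List.∈ σ List.++ rest)
    completion a σ σ-unique σ-avoids = rest , τ-unique , τ-avoids , τ-covers
      where
      open DecMembership _≟ᵛ_ using (_∈?_)
      rest = List.filter (λ v → ¬? (v ∈? σ)) (List.tabulate (avoiding a))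

      τ-unique : List.Unique (σ List.++ rest)
      τ-unique = ListUnique.++⁺ σ-unique
        (ListUnique.filter⁺ (λ v → ¬? (v ∈? σ)) (ListUnique.tabulate⁺ (avoiding-injective a)))
        (λ (v∈σ , v∈rest) → proj₂ (∈-filter⁻ (λ v → ¬? (v ∈? σ)) {xs = List.tabulate (avoiding a)} v∈rest) v∈σ)

      τ-avoids : ∀ {v} → v List.∈ σ List.++ rest → Avoids a v
      τ-avoids v∈τ with ∈-++⁻ σ v∈τ
      ... | inj₁ v∈σ = ListAll.lookup σ-avoids v∈σ
      ... | inj₂ v∈rest with ∈-tabulate⁻ (proj₁ (∈-filter⁻ (λ v → ¬? (v ∈? σ)) {xs = List.tabulate (avoiding a)} v∈rest))
      ...   | r , refl = avoiding-avoids a r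

      τ-covers : ∀ v → Avoids a v → v List.∈ σ List.++ rest
      τ-covers v v-avoids with v ∈? σ
      ... | yes v∈σ = ∈-++⁺ˡ v∈σ
      ... | no v∉σ with avoiding-surjective a v v-avoids
      ...   | r , refl = ∈-++⁺ʳ σ (∈-filter⁺ (λ v → ¬? (v ∈? σ)) (∈-tabulate⁺ r) v∉σ)

    simplex⇒partOfBasis : ∀ (M : MonoSet c) σ → IsSimplex c M σ → PartOfBasisℤ (fromList (List.map Λ σ))
    simplex⇒partOfBasis M σ (σ-unique , F , σ⊆F) =
      _ , fromList (List.map Λ rest) ,
      fromList-map⁺ Λ (λ v → IsBasisℤ (v ++ fromList (List.map Λ rest))) σ
        (fromList-map⁺ Λ (λ v → IsBasisℤ (map Λ (fromList σ) ++ v)) rest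
          (subst IsBasisℤ (map-++ Λ (fromList σ) (fromList rest))
            (AvoidingEnumeration.basis a xs (toList⁻-Unique xs (subst List.Unique (sym toList-xs) τ-unique))
              (λ v∈xs → τ-avoids (subst (_ List.∈_) toList-xs (∈-toList⁺ v∈xs)))
              (λ v v-avoids → ∈-toList⁻ (subst (v List.∈_) (sym toList-xs) (τ-covers v v-avoids))))))
      where
      a = FacetData.mono F
      completed = completion a σ σ-unique (ListAll.map proj₁ σ⊆F)
      rest = proj₁ completed
      τ-unique = proj₁ (proj₂ completed)
      τ-avoids = proj₁ (proj₂ (proj₂ completed))
      τ-covers = proj₂ (proj₂ (proj₂ completed))
      xs = fromList σ ++ fromList rest
      toList-xs : toList xs ≡ σ List.++ rest
      toList-xs = trans (toList-++ (fromList σ) (fromList rest)) (cong₂ List._++_ (toList∘fromList σ) (toList∘fromList rest))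

    Λ-characteristic : ∀ (M : MonoSet c) → ZCharMap (Vertex c) (IsSimplex c M) ∣ c ∣c
    Λ-characteristic M = Λ , simplex⇒partOfBasis M

    ◇-id : ∀ (a : Mono c) i j → j ≡ a i → ∀ k → (a ◇ (i , j)) k ≡ a k
    ◇-id a i j j≡aᵢ k with k Fin.≟ i
    ... | yes refl = j≡aᵢ
    ... | no _ = refl

    ≗⇒∣ᵐ : ∀ {a b : Mono c} → (∀ k → b k ≡ a k) → b ∣ᵐ a
    ≗⇒∣ᵐ b≗a k = ℕP.≤-reflexive (cong Fin.toℕ (b≗a k))

    prefix : ℕ → Mono c → Mono c
    prefix q b k with Fin.toℕ k <? q
    ... | yes _ = b k
    ... | no _ = zero

    prefix-< : ∀ q b k → Fin.toℕ k ℕ.< q → prefix q b k ≡ b k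
    prefix-< q b k k<q with Fin.toℕ k <? q
    ... | yes _ = refl
    ... | no k≮q = contradiction k<q k≮q

    prefix-≮ : ∀ q b k → ¬ Fin.toℕ k ℕ.< q → prefix q b k ≡ zero
    prefix-≮ q b k k≮q with Fin.toℕ k <? q
    ... | yes k<q = contradiction k<q k≮q
    ... | no _ = refl

    prefix-suc : ∀ q b (q<m : q ℕ.< m) k →
      (prefix q b ◇ (Fin.fromℕ< q<m , b (Fin.fromℕ< q<m))) k ≡ prefix (ℕ.suc q) b k
    prefix-suc q b q<m k with k Fin.≟ Fin.fromℕ< q<m
    ... | yes refl = sym (prefix-< (ℕ.suc q) b k (ℕP.≤-reflexive (cong ℕ.suc (toℕ-fromℕ< q<m))))
    ... | no k≢i with Fin.toℕ k <? q
    ...   | yes k<q = sym (prefix-< (ℕ.suc q) b k (ℕP.m≤n⇒m≤1+n k<q))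
    ...   | no k≮q = sym (prefix-≮ (ℕ.suc q) b k λ k<1+q →
              k≮q (ℕP.≤∧≢⇒< (ℕ.s≤s⁻¹ k<1+q) λ k≡q → k≢i (toℕ-injective (trans k≡q (sym (toℕ-fromℕ< q<m))))))

    module _ (M : MonoSet c) (multicomplex : IsMulticomplex c M) where

      absent-upward : ∀ {a b} → b ∣ᵐ a → M b ≡ false → M a ≡ false
      absent-upward {a} {b} b∣a Mb≡false with M a in Ma
      ... | true = contradiction (trans (sym (proj₂ multicomplex a b b∣a Ma)) Mb≡false) λ ()
      ... | false = refl

      -- Walking from prefix 0 b = x^0 ∈ M to prefix m b = b ∉ M, the step where we leave M is a facet.
      facet : IsProper c M → FacetData c M
      facet (b , b∉M) = facet-at (crossing (M ∘ flip prefix b) start m finish)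
        where
        start : M (prefix 0 b) ≡ true
        start = proj₂ multicomplex _ _ (λ k → ℕP.≤-trans (ℕP.≤-reflexive (cong Fin.toℕ (prefix-≮ 0 b k λ ()))) ℕ.z≤n)
                  (proj₂ (proj₁ multicomplex))
        finish : M (prefix m b) ≡ false
        finish = absent-upward (≗⇒∣ᵐ (λ k → sym (prefix-< m b k (toℕ<n k)))) b∉M

        facet-at : (∃ λ q → q ℕ.< m × M (prefix q b) ≡ true × M (prefix (ℕ.suc q) b) ≡ false) → FacetData c M
        facet-at (q , q<m , inM , outM) = record
          { mono = a ; var = i ; expo = b i ; inM = inM ; larger = larger ; notInM = notInM }
          where
          a = prefix q b
          i = Fin.fromℕ< q<m
          notInM : M (a ◇ (i , b i)) ≡ false
          notInM = absent-upward (≗⇒∣ᵐ (λ k → sym (prefix-suc q b q<m k))) outM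
          aᵢ≡0 : a i ≡ zero
          aᵢ≡0 = prefix-≮ q b i (ℕP.<-irrefl (toℕ-fromℕ< q<m))
          larger : Fin.toℕ (a i) ℕ.< Fin.toℕ (b i)
          larger with b i in bᵢ
          ... | suc _ rewrite aᵢ≡0 = ℕ.z<s
          ... | zero = contradiction
            (trans (sym (proj₂ multicomplex a (a ◇ (i , b i)) (≗⇒∣ᵐ (◇-id a i (b i) (trans bᵢ (sym aᵢ≡0)))) inM)) notInM)
            λ ()

    -- G(x^a; x_i^j) has |c| − 1 vertices: those avoided by x^a, except x_i^(j).
    facet-simplex : ∀ (M : MonoSet c) (F : FacetData c M) →
      ∃ λ σ → ℕ.suc (List.length σ) ≡ ∣ c ∣c × IsSimplex c M σ
    facet-simplex M F =
      let σ , length , unique , σ⊆F = tabulate-except (avoiding a) (avoiding-injective a) r₀ (InFacet F) in-facet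
      in σ , length , unique , F , σ⊆F
      where
      open FacetData F renaming (mono to a; var to i; expo to j)
      j≢aᵢ : j ≢ a i
      j≢aᵢ j≡aᵢ = ℕP.<-irrefl (cong Fin.toℕ (sym j≡aᵢ)) larger
      r₀ = proj₁ (avoiding-surjective a (i , j) j≢aᵢ)
      in-facet : ∀ r → r ≢ r₀ → InFacet F (avoiding a r)
      in-facet r r≢r₀ = avoiding-avoids a r , λ r↦ij →
        r≢r₀ (avoiding-injective a (trans r↦ij (sym (proj₂ (avoiding-surjective a (i , j) j≢aᵢ)))))

open import Data.Nat using (ℕ; suc; _+_; _≤_; s≤s; nonTrivial⇒n>1)
open import Data.Nat.Primality using (Prime; prime⇒nonZero; prime⇒nonTrivial)
open import Data.List using (length)
open BuchstaberNumbers
open MuraiSphere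

mainTheorem11 :
    (m : ℕ) (c : Fin m → ℕ) → (∀ i → 1 ≤ c i) →
    (M : MonoSet c) → IsMulticomplex c M → IsProper c M →
    (f₀ : ℕ) → NumRealVertices c M f₀ →
    (s : ℕ) → IsComplexBuchstaber (Vertex c) (IsSimplex c M) f₀ s →
    (p : ℕ) → Prime p →
    (sₚ : ℕ) → IsModpBuchstaber p (Vertex c) (IsSimplex c M) f₀ sₚ →
    (f₀ ≤ s + ∣ c ∣c) × (s ≤ sₚ) × (sₚ + ∣ c ∣c ≤ f₀ + 1)
-- Λ is defined on all of X̃.
mainTheorem11 m c _ M multicomplex proper f₀ _ s s-buchstaber p p-prime sₚ sₚ-buchstaber =
  ZCharMap⇒N≤s+k s-buchstaber (Λ-characteristic c M) ,
  complex≤modp-Buchstaber p s-buchstaber sₚ-buchstaber ,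
  (begin
    sₚ + ∣ c ∣c          ≡⟨ cong (sₚ +_) length+1 ⟨
    sₚ + suc (length σ)  ≡⟨ ℕP.+-suc sₚ _ ⟩
    suc (sₚ + length σ)  ≤⟨ s≤s (modp-Buchstaber+length≤ 1<p sₚ-buchstaber σ σ-simplex) ⟩
    suc f₀               ≡⟨ ℕP.+-comm 1 f₀ ⟩
    f₀ + 1               ∎)
  where
  open ℕP.≤-Reasoning
  instance
    p≢0 = prime⇒nonZero p-prime
  1<p = nonTrivial⇒n>1 p {{prime⇒nonTrivial p-prime}}
  facet-vertices = facet-simplex c M (facet c M multicomplex proper)
  σ = proj₁ facet-vertices
  length+1 = proj₁ (proj₂ facet-vertices)
  σ-simplex = proj₂ (proj₂ facet-vertices)
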